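{- Let $n\ge 2$ and let $S_{n+1}=K_{1,n}$ be the star with $n$ leaves. Then the Smith normal form of $A^{\operatorname{trs}}(S_{n+1})$ and the Smith normal form of $A^{\operatorname{trs}}_+(S_{n+1})$ are both equal to the $(n+1)\times(n+1)$ diagonal matrix $$\operatorname{diag}(1,1,\underbrace{2n-1,\ldots,2n-1}_{n-2},\,2n(n-1)(2n-1)).$$
   Context: For a connected graph $G$ with adjacency matrix $A$ and transmission vector $\operatorname{trs}(G)$ (where $\operatorname{trs}(v)=\sum_{u} d(u,v)$, $d$ the graph distance), $A^{\operatorname{trs}}(G)=\operatorname{diag}(\operatorname{trs}(G))-A$ and $A^{\operatorname{trs}}_+(G)=\operatorname{diag}(\operatorname{trs}(G))+A$. The Smith normal form is taken over $\mathbb{Z}$. -}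

module Defs where

open import Data.Nat as ℕ using (ℕ; zero; suc)
open import Data.Integer as ℤ using (ℤ; +_; 0ℤ; 1ℤ)
open import Data.Integer.Divisibility using (_∣_)
open import Data.Fin using (Fin; zero; suc; toℕ; inject₁)
open import Data.Bool using (Bool; true; false)
open import Data.Product using (Σ; _×_; ∃; ∃-syntax)
open import Relation.Binary.PropositionalEquality using (_≡_; _≢_)
open import Relation.Nullary using (yes; no)

Mat : ℕ → ℕ → Set
Mat m n = Fin m → Fin n → ℤ

Σℤ : ∀ {n} → (Fin n → ℤ) → ℤ
Σℤ {zero}  f = 0ℤ
Σℤ {suc n} f = f zero ℤ.+ Σℤ (λ i → f (suc i))

Σℕ : ∀ {n} → (Fin n → ℕ) → ℕ
Σℕ {zero}  f = 0
Σℕ {suc n} f = f zero ℕ.+ Σℕ (λ i → f (suc i))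

_⊗_ : ∀ {m k n} → Mat m k → Mat k n → Mat m n
(A ⊗ B) i j = Σℤ (λ l → A i l ℤ.* B l j)

_≈M_ : ∀ {m n} → Mat m n → Mat m n → Set
A ≈M B = ∀ i j → A i j ≡ B i j

δ : ∀ {n} → Fin n → Fin n → ℤ
δ zero    zero    = 1ℤ
δ zero    (suc _) = 0ℤ
δ (suc _) zero    = 0ℤ
δ (suc i) (suc j) = δ i j

I : ∀ {n} → Mat n n
I = δ

Unimodular : ∀ {n} → Mat n n → Set
Unimodular {n} P = Σ (Mat n n) λ Q → ((P ⊗ Q) ≈M I) × ((Q ⊗ P) ≈M I)

IsSmithForm : ∀ {n} → Mat n n → Set
IsSmithForm {n} D =
  (∀ i j → i ≢ j → D i j ≡ 0ℤ) ×
  (∀ i → 0ℤ ℤ.≤ D i i) ×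
  (∀ (i : Fin n) (j : Fin n) → toℕ j ≡ suc (toℕ i) → D i i ∣ D j j)

-- "the Smith normal form of A is D": D is in Smith form and D = P A Q
-- with P, Q unimodular (the Smith form is unique, so this determines D)
SNFis : ∀ {n} → Mat n n → Mat n n → Set
SNFis {n} A D =
  IsSmithForm D ×
  ∃[ P ] ∃[ Q ] (Unimodular P × Unimodular Q × (((P ⊗ A) ⊗ Q) ≈M D))

Graph : ℕ → Set
Graph N = Fin N → Fin N → Bool

data Walk {N} (G : Graph N) : Fin N → Fin N → ℕ → Set where
  here : ∀ {u} → Walk G u u 0
  step : ∀ {u w v k} → G u w ≡ true → Walk G w v k → Walk G u v (suc k)

IsDistance : ∀ {N} → Graph N → (Fin N → Fin N → ℕ) → Set
IsDistance G d =
  ∀ u v → Walk G u v (d u v) × (∀ k → Walk G u v k → d u v ℕ.≤ k)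

b2ℤ : Bool → ℤ
b2ℤ true  = 1ℤ
b2ℤ false = 0ℤ

adjMat : ∀ {N} → Graph N → Mat N N
adjMat G i j = b2ℤ (G i j)

trs : ∀ {N} → (Fin N → Fin N → ℕ) → Fin N → ℕ
trs d v = Σℕ (λ u → d u v)

diagTrs : ∀ {N} → (Fin N → Fin N → ℕ) → Mat N N
diagTrs d i j = δ i j ℤ.* + trs d i

Atrs : ∀ {N} → Graph N → (Fin N → Fin N → ℕ) → Mat N N
Atrs G d i j = diagTrs d i j ℤ.- adjMat G i j

AtrsPlus : ∀ {N} → Graph N → (Fin N → Fin N → ℕ) → Mat N N
AtrsPlus G d i j = diagTrs d i j ℤ.+ adjMat G i j

star : (n : ℕ) → Graph (suc n)
star n zero    zero    = false
star n zero    (suc _) = true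
star n (suc _) zero    = true
star n (suc _) (suc _) = false

starSNFentry : (n : ℕ) → ℕ → ℕ
starSNFentry n zero          = 1
starSNFentry n (suc zero)    = 1
starSNFentry n (suc (suc k)) with ℕ._≟_ (suc (suc k)) n
... | yes _ = 2 ℕ.* n ℕ.* (n ℕ.∸ 1) ℕ.* (2 ℕ.* n ℕ.∸ 1)
... | no  _ = 2 ℕ.* n ℕ.∸ 1

starSNF : (n : ℕ) → Mat (suc n) (suc n)
starSNF n i j = δ i j ℤ.* + starSNFentry n (toℕ i)

module Submission where

-- For n = k + 2 the hub of the star has transmission n and every leaf 2n − 1, so A^trs and
-- A^trs_+ are diag(n, 2n − 1, …, 2n − 1) ∓ A. These matrices are invariant under permutations
-- of the leaves 2, …, n − 1, and a reduction to the Smith form can be found among such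
-- matrices: those whose entries depend only on whether an index is the hub, the first leaf, the
-- last leaf or one of the k remaining bulk leaves, with bulk block αI + βJ, form a ring whose
-- product is polynomial in k. We give P, Q and their inverses in this ring with P A Q = D; the
-- five matrix identities needed are identities between patterns of polynomials in k, decided
-- by normalising their differences.

open import Defs
open import Data.Nat as ℕ using (ℕ; zero; suc; _≤_; s≤s; z≤n)
import Data.Nat.Properties as ℕP
open import Data.Nat.Divisibility as ℕD using (divides; ∣-refl; 1∣_)
import Data.Nat.Tactic.RingSolver as ℕSolver
open import Data.Integer using (ℤ; +_; 0ℤ; 1ℤ; -1ℤ; _+_; _*_; -_)
import Data.Integer as ℤ
import Data.Integer.Properties as ℤP
open import Data.Integer.Tactic.RingSolver using (solve-∀)
open import Data.Fin using (Fin; zero; suc; toℕ; inject₁; fromℕ)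
import Data.Fin.Properties as FinP
import Data.Fin.Relation.Unary.Top as Top
open import Data.Bool using (Bool; true; false; _∧_; _xor_; T)
open import Data.Bool.Properties using (T-∧; xor-identityʳ)
open import Data.Unit using (tt)
open import Data.Empty using (⊥-elim)
open import Data.Product using (_×_; _,_; proj₁; proj₂)
open import Data.List using (List; []; _∷_; map)
open import Function using (_∘_; Equivalence)
open import Relation.Binary.PropositionalEquality
open import Relation.Nullary using (yes; no)

δ-sym : ∀ {n} (i j : Fin n) → δ i j ≡ δ j i
δ-sym zero    zero    = refl
δ-sym zero    (suc j) = refl
δ-sym (suc i) zero    = refl
δ-sym (suc i) (suc j) = δ-sym i j

δ-≢ : ∀ {n} (i j : Fin n) → i ≢ j → δ i j ≡ 0ℤ
δ-≢ zero    zero    i≢j = ⊥-elim (i≢j refl)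
δ-≢ zero    (suc j) i≢j = refl
δ-≢ (suc i) zero    i≢j = refl
δ-≢ (suc i) (suc j) i≢j = δ-≢ i j (i≢j ∘ cong suc)

δ-inject₁ : ∀ {k} (x y : Fin k) → δ (inject₁ x) (inject₁ y) ≡ δ x y
δ-inject₁ zero    zero    = refl
δ-inject₁ zero    (suc y) = refl
δ-inject₁ (suc x) zero    = refl
δ-inject₁ (suc x) (suc y) = δ-inject₁ x y

δ-inject₁-fromℕ : ∀ {k} (x : Fin k) → δ (inject₁ x) (fromℕ k) ≡ 0ℤ
δ-inject₁-fromℕ zero    = refl
δ-inject₁-fromℕ (suc x) = δ-inject₁-fromℕ x

δ-refl : ∀ {n} (i : Fin n) → δ i i ≡ 1ℤ
δ-refl zero    = refl
δ-refl (suc i) = δ-refl i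

Σℤ-cong : ∀ {n} {f g : Fin n → ℤ} → (∀ i → f i ≡ g i) → Σℤ f ≡ Σℤ g
Σℤ-cong {zero}  f≗g = refl
Σℤ-cong {suc n} f≗g = cong₂ _+_ (f≗g zero) (Σℤ-cong (f≗g ∘ suc))

Σℤ-+ : ∀ {n} (f g : Fin n → ℤ) → Σℤ (λ i → f i + g i) ≡ Σℤ f + Σℤ g
Σℤ-+ {zero}  f g = refl
Σℤ-+ {suc n} f g = trans (cong (_+_ (f zero + g zero)) (Σℤ-+ (f ∘ suc) (g ∘ suc)))
                         (interchange (f zero) (g zero) _ _)
  where
  interchange : ∀ x y u v → (x + y) + (u + v) ≡ (x + u) + (y + v)
  interchange = solve-∀

Σℤ-const : ∀ {n} v → Σℤ {n} (λ _ → v) ≡ + n * v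
Σℤ-const {zero}  v = refl
Σℤ-const {suc n} v = trans (cong (_+_ v) (Σℤ-const {n} v)) (suc-* v (+ n))
  where
  suc-* : ∀ v m → v + m * v ≡ (1ℤ + m) * v
  suc-* = solve-∀

Σℤ-δˡ : ∀ {n} (i : Fin n) (f : Fin n → ℤ) → Σℤ (λ j → δ i j * f j) ≡ f i
Σℤ-δˡ {suc n} zero f = begin
  1ℤ * f zero + Σℤ {n} (λ _ → 0ℤ) ≡⟨ cong₂ _+_ (ℤP.*-identityˡ (f zero)) (Σℤ-const {n} 0ℤ) ⟩
  f zero + + n * 0ℤ               ≡⟨ cong (_+_ (f zero)) (ℤP.*-zeroʳ (+ n)) ⟩
  f zero + 0ℤ                     ≡⟨ ℤP.+-identityʳ (f zero) ⟩
  f zero                          ∎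
  where open ≡-Reasoning
Σℤ-δˡ {suc n} (suc i) f = trans (ℤP.+-identityˡ _) (Σℤ-δˡ i (f ∘ suc))

Σℤ-δʳ : ∀ {n} (i : Fin n) (f : Fin n → ℤ) → Σℤ (λ j → δ j i * f j) ≡ f i
Σℤ-δʳ i f = trans (Σℤ-cong (λ j → cong (_* f j) (δ-sym j i))) (Σℤ-δˡ i f)

Σℤ-init-last : ∀ {k} (f : Fin (suc k) → ℤ) → Σℤ f ≡ Σℤ (f ∘ inject₁) + f (fromℕ k)
Σℤ-init-last {zero}  f = trans (ℤP.+-identityʳ (f zero)) (sym (ℤP.+-identityˡ (f zero)))
Σℤ-init-last {suc k} f = trans (cong (_+_ (f zero)) (Σℤ-init-last (f ∘ suc)))
                               (sym (ℤP.+-assoc (f zero) _ _))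

Σℤ-row : ∀ {k} (y : Fin k) v d w → Σℤ {k} (λ j → v * (d * δ j y + w)) ≡ v * d + + k * (v * w)
Σℤ-row {k} y v d w = begin
  Σℤ (λ j → v * (d * δ j y + w))            ≡⟨ Σℤ-cong (λ j → expand v d w (δ j y)) ⟩
  Σℤ (λ j → δ j y * (v * d) + v * w)        ≡⟨ Σℤ-+ (λ j → δ j y * (v * d)) _ ⟩
  Σℤ (λ j → δ j y * (v * d)) + Σℤ {k} (λ _ → v * w)
    ≡⟨ cong₂ _+_ (Σℤ-δʳ y (λ _ → v * d)) (Σℤ-const {k} (v * w)) ⟩
  v * d + + k * (v * w)                     ∎
  where
  open ≡-Reasoning
  expand : ∀ v d w e → v * (d * e + w) ≡ e * (v * d) + v * w
  expand = solve-∀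

Σℤ-col : ∀ {k} (x : Fin k) v d w → Σℤ {k} (λ j → (d * δ x j + w) * v) ≡ d * v + + k * (w * v)
Σℤ-col {k} x v d w = begin
  Σℤ (λ j → (d * δ x j + w) * v)            ≡⟨ Σℤ-cong (λ j → expand v d w (δ x j)) ⟩
  Σℤ (λ j → δ x j * (d * v) + w * v)        ≡⟨ Σℤ-+ (λ j → δ x j * (d * v)) _ ⟩
  Σℤ (λ j → δ x j * (d * v)) + Σℤ {k} (λ _ → w * v)
    ≡⟨ cong₂ _+_ (Σℤ-δˡ x (λ _ → d * v)) (Σℤ-const {k} (w * v)) ⟩
  d * v + + k * (w * v)                     ∎
  where
  open ≡-Reasoning
  expand : ∀ v d w e → (d * e + w) * v ≡ e * (d * v) + w * v
  expand = solve-∀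

Σℤ-block : ∀ {k} (x y : Fin k) d w d′ w′ →
  Σℤ {k} (λ j → (d * δ x j + w) * (d′ * δ j y + w′))
    ≡ (d * d′) * δ x y + ((d * w′ + w * d′) + + k * (w * w′))
Σℤ-block {k} x y d w d′ w′ = begin
  Σℤ (λ j → (d * δ x j + w) * (d′ * δ j y + w′))
    ≡⟨ Σℤ-cong (λ j → expand d w d′ w′ (δ x j) (δ j y)) ⟩
  Σℤ (λ j → δ x j * (d * (d′ * δ j y + w′)) + w * (d′ * δ j y + w′))
    ≡⟨ Σℤ-+ (λ j → δ x j * (d * (d′ * δ j y + w′))) _ ⟩
  Σℤ (λ j → δ x j * (d * (d′ * δ j y + w′))) + Σℤ (λ j → w * (d′ * δ j y + w′))
    ≡⟨ cong₂ _+_ (Σℤ-δˡ x (λ j → d * (d′ * δ j y + w′))) (Σℤ-row y w d′ w′) ⟩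
  d * (d′ * δ x y + w′) + (w * d′ + + k * (w * w′))
    ≡⟨ collect d w d′ w′ (δ x y) (+ k) ⟩
  (d * d′) * δ x y + ((d * w′ + w * d′) + + k * (w * w′)) ∎
  where
  open ≡-Reasoning
  expand : ∀ d w d′ w′ e f → (d * e + w) * (d′ * f + w′) ≡ e * (d * (d′ * f + w′)) + w * (d′ * f + w′)
  expand = solve-∀
  collect : ∀ d w d′ w′ e K → d * (d′ * e + w′) + (w * d′ + K * (w * w′))
                    ≡ (d * d′) * e + ((d * w′ + w * d′) + K * (w * w′))
  collect = solve-∀

⊗-congˡ : ∀ {m k n} {A A′ : Mat m k} {B : Mat k n} → A ≈M A′ → (A ⊗ B) ≈M (A′ ⊗ B)
⊗-congˡ {B = B} A≈A′ i j = Σℤ-cong (λ l → cong (_* B l j) (A≈A′ i l))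

⊗-congʳ : ∀ {m k n} {A : Mat m k} {B B′ : Mat k n} → B ≈M B′ → (A ⊗ B) ≈M (A ⊗ B′)
⊗-congʳ {A = A} B≈B′ i j = Σℤ-cong (λ l → cong (A i l *_) (B≈B′ l j))

walk-length-0 : ∀ {N} {G : Graph N} {u v} → Walk G u v 0 → u ≡ v
walk-length-0 here = refl

walk-length-1 : ∀ {N} {G : Graph N} {u v} → Walk G u v 1 → G u v ≡ true
walk-length-1 (step uv here) = uv

module _ {N} {G : Graph N} {d : Fin N → Fin N → ℕ} (isDist : IsDistance G d) where

  distance-refl : ∀ u → d u u ≡ 0
  distance-refl u = ℕP.n≤0⇒n≡0 (proj₂ (isDist u u) 0 here)

  distance-adjacent : ∀ {u v} → G u v ≡ true → u ≢ v → d u v ≡ 1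
  distance-adjacent {u} {v} uv u≢v with d u v | proj₁ (isDist u v) | proj₂ (isDist u v) 1 (step uv here)
  ... | 0           | w₀ | _       = ⊥-elim (u≢v (walk-length-0 w₀))
  ... | 1           | _  | _       = refl
  ... | suc (suc _) | _  | s≤s ()

  distance-two : ∀ {u v} → Walk G u v 2 → G u v ≡ false → u ≢ v → d u v ≡ 2
  distance-two {u} {v} w uv̸ u≢v with d u v | proj₁ (isDist u v) | proj₂ (isDist u v) 2 w
  ... | 0                 | w₀ | _ = ⊥-elim (u≢v (walk-length-0 w₀))
  ... | 1                 | w₁ | _ with () ← trans (sym uv̸) (walk-length-1 w₁)
  ... | 2                 | _  | _ = refl
  ... | suc (suc (suc _)) | _  | s≤s (s≤s ())

isZero : ∀ {n} → Fin n → Bool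
isZero zero    = true
isZero (suc _) = false

star-isZero : ∀ {n} (i j : Fin (suc n)) → star n i j ≡ isZero i xor isZero j
star-isZero zero    zero    = refl
star-isZero zero    (suc _) = refl
star-isZero (suc _) zero    = refl
star-isZero (suc _) (suc _) = refl

leafDistance : ∀ {N} → Fin N → Fin N → ℕ
leafDistance zero    zero    = 0
leafDistance zero    (suc _) = 2
leafDistance (suc _) zero    = 2
leafDistance (suc i) (suc j) = leafDistance i j

leafDistance-refl : ∀ {N} (i : Fin N) → leafDistance i i ≡ 0
leafDistance-refl zero    = refl
leafDistance-refl (suc i) = leafDistance-refl i

leafDistance-≢ : ∀ {N} (i j : Fin N) → i ≢ j → leafDistance i j ≡ 2
leafDistance-≢ zero    zero    i≢j = ⊥-elim (i≢j refl)
leafDistance-≢ zero    (suc j) i≢j = refl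
leafDistance-≢ (suc i) zero    i≢j = refl
leafDistance-≢ (suc i) (suc j) i≢j = leafDistance-≢ i j (i≢j ∘ cong suc)

Σℕ-cong : ∀ {N} {f g : Fin N → ℕ} → (∀ i → f i ≡ g i) → Σℕ f ≡ Σℕ g
Σℕ-cong {zero}  f≗g = refl
Σℕ-cong {suc N} f≗g = cong₂ ℕ._+_ (f≗g zero) (Σℕ-cong (f≗g ∘ suc))

Σℕ-const : ∀ {N} c → Σℕ {N} (λ _ → c) ≡ N ℕ.* c
Σℕ-const {zero}  c = refl
Σℕ-const {suc N} c = cong (c ℕ.+_) (Σℕ-const {N} c)

Σℕ-leafDistance : ∀ N (j : Fin (suc N)) → Σℕ (λ i → leafDistance i j) ≡ 2 ℕ.* N
Σℕ-leafDistance N       zero    = trans (Σℕ-const {N} 2) (ℕP.*-comm N 2)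
Σℕ-leafDistance (suc N) (suc j) = trans (cong (2 ℕ.+_) (Σℕ-leafDistance N j)) (sym (ℕP.*-suc 2 N))

module _ {n} {d : Fin (suc n) → Fin (suc n) → ℕ} (isDist : IsDistance (star n) d) where

  star-distance-hub : ∀ i → d (suc i) zero ≡ 1
  star-distance-hub i = distance-adjacent isDist refl (λ ())

  star-distance-leaf : ∀ i j → d (suc i) (suc j) ≡ leafDistance i j
  star-distance-leaf i j with i FinP.≟ j
  ... | yes refl = trans (distance-refl isDist (suc i)) (sym (leafDistance-refl i))
  ... | no  i≢j  = trans (distance-two isDist (step {w = zero} refl (step refl here)) refl (i≢j ∘ FinP.suc-injective))
                         (sym (leafDistance-≢ i j i≢j))

  trs-hub : trs d zero ≡ n
  trs-hub = begin
    d zero zero ℕ.+ Σℕ (λ i → d (suc i) zero) ≡⟨ cong₂ ℕ._+_ (distance-refl isDist zero) (Σℕ-cong star-distance-hub) ⟩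
    Σℕ {n} (λ _ → 1)                        ≡⟨ Σℕ-const {n} 1 ⟩
    n ℕ.* 1                                 ≡⟨ ℕP.*-identityʳ n ⟩
    n                                       ∎
    where open ≡-Reasoning

module _ {N} {d : Fin (suc (suc N)) → Fin (suc (suc N)) → ℕ} (isDist : IsDistance (star (suc N)) d) where

  trs-leaf : ∀ j → trs d (suc j) ≡ suc (2 ℕ.* N)
  trs-leaf j = cong₂ ℕ._+_ (distance-adjacent isDist refl (λ ()))
                           (trans (Σℕ-cong (λ i → star-distance-leaf isDist i j)) (Σℕ-leafDistance N j))

-- Polynomials in one variable, as coefficient lists

Poly : Set
Poly = List ℤ

-- The middle clause makes constants evaluate to themselves definitionally.
⟦_⟧ : Poly → ℤ → ℤ
⟦ [] ⟧          K = 0ℤ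
⟦ x ∷ [] ⟧      K = x
⟦ x ∷ p@(_ ∷ _) ⟧ K = x + K * ⟦ p ⟧ K

⟦⟧-∷ : ∀ x p K → ⟦ x ∷ p ⟧ K ≡ x + K * ⟦ p ⟧ K
⟦⟧-∷ x []      K = sym (trans (cong (_+_ x) (ℤP.*-zeroʳ K)) (ℤP.+-identityʳ x))
⟦⟧-∷ x (_ ∷ _) K = refl

1ᴾ Xᴾ : Poly
1ᴾ = 1ℤ ∷ []
Xᴾ = 0ℤ ∷ 1ℤ ∷ []

infixl 6 _+ᴾ_
infixl 7 _*ᴾ_

_+ᴾ_ : Poly → Poly → Poly
[]      +ᴾ q       = q
(x ∷ p) +ᴾ []      = x ∷ p
(x ∷ p) +ᴾ (y ∷ q) = (x + y) ∷ (p +ᴾ q)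

scaleᴾ : ℤ → Poly → Poly
scaleᴾ c = map (c *_)

_*ᴾ_ : Poly → Poly → Poly
[]      *ᴾ q = []
(x ∷ p) *ᴾ q = scaleᴾ x q +ᴾ (0ℤ ∷ p *ᴾ q)

-ᴾ_ : Poly → Poly
-ᴾ_ = scaleᴾ -1ℤ

⟦X⟧ : ∀ K → ⟦ Xᴾ ⟧ K ≡ K
⟦X⟧ K = trans (ℤP.+-identityˡ _) (ℤP.*-identityʳ K)

⟦⟧-+ : ∀ p q K → ⟦ p +ᴾ q ⟧ K ≡ ⟦ p ⟧ K + ⟦ q ⟧ K
⟦⟧-+ []      q       K = sym (ℤP.+-identityˡ _)
⟦⟧-+ (x ∷ p) []      K = sym (ℤP.+-identityʳ _)
⟦⟧-+ (x ∷ p) (y ∷ q) K = begin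
  ⟦ (x + y) ∷ (p +ᴾ q) ⟧ K            ≡⟨ ⟦⟧-∷ (x + y) (p +ᴾ q) K ⟩
  (x + y) + K * ⟦ p +ᴾ q ⟧ K          ≡⟨ cong (λ s → (x + y) + K * s) (⟦⟧-+ p q K) ⟩
  (x + y) + K * (⟦ p ⟧ K + ⟦ q ⟧ K)   ≡⟨ regroup x y K _ _ ⟩
  (x + K * ⟦ p ⟧ K) + (y + K * ⟦ q ⟧ K) ≡˘⟨ cong₂ _+_ (⟦⟧-∷ x p K) (⟦⟧-∷ y q K) ⟩
  ⟦ x ∷ p ⟧ K + ⟦ y ∷ q ⟧ K            ∎
  where
  open ≡-Reasoning
  regroup : ∀ x y K u v → (x + y) + K * (u + v) ≡ (x + K * u) + (y + K * v)
  regroup = solve-∀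

⟦⟧-scale : ∀ c p K → ⟦ scaleᴾ c p ⟧ K ≡ c * ⟦ p ⟧ K
⟦⟧-scale c []      K = sym (ℤP.*-zeroʳ c)
⟦⟧-scale c (x ∷ p) K = begin
  ⟦ c * x ∷ scaleᴾ c p ⟧ K       ≡⟨ ⟦⟧-∷ (c * x) (scaleᴾ c p) K ⟩
  c * x + K * ⟦ scaleᴾ c p ⟧ K   ≡⟨ cong (λ s → c * x + K * s) (⟦⟧-scale c p K) ⟩
  c * x + K * (c * ⟦ p ⟧ K)      ≡⟨ factor c x K _ ⟩
  c * (x + K * ⟦ p ⟧ K)          ≡˘⟨ cong (c *_) (⟦⟧-∷ x p K) ⟩
  c * ⟦ x ∷ p ⟧ K                ∎
  where
  open ≡-Reasoning
  factor : ∀ c x K u → c * x + K * (c * u) ≡ c * (x + K * u)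
  factor = solve-∀

⟦⟧-* : ∀ p q K → ⟦ p *ᴾ q ⟧ K ≡ ⟦ p ⟧ K * ⟦ q ⟧ K
⟦⟧-* []      q K = refl
⟦⟧-* (x ∷ p) q K = begin
  ⟦ scaleᴾ x q +ᴾ (0ℤ ∷ p *ᴾ q) ⟧ K             ≡⟨ ⟦⟧-+ (scaleᴾ x q) _ K ⟩
  ⟦ scaleᴾ x q ⟧ K + ⟦ 0ℤ ∷ p *ᴾ q ⟧ K          ≡⟨ cong₂ _+_ (⟦⟧-scale x q K) (⟦⟧-∷ 0ℤ (p *ᴾ q) K) ⟩
  x * ⟦ q ⟧ K + (0ℤ + K * ⟦ p *ᴾ q ⟧ K)         ≡⟨ cong (λ s → x * ⟦ q ⟧ K + (0ℤ + K * s)) (⟦⟧-* p q K) ⟩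
  x * ⟦ q ⟧ K + (0ℤ + K * (⟦ p ⟧ K * ⟦ q ⟧ K))  ≡⟨ factor x K _ _ ⟩
  (x + K * ⟦ p ⟧ K) * ⟦ q ⟧ K                    ≡˘⟨ cong (_* ⟦ q ⟧ K) (⟦⟧-∷ x p K) ⟩
  ⟦ x ∷ p ⟧ K * ⟦ q ⟧ K                          ∎
  where
  open ≡-Reasoning
  factor : ∀ x K u v → x * v + (0ℤ + K * (u * v)) ≡ (x + K * u) * v
  factor = solve-∀

isZeroᴾ : Poly → Bool
isZeroᴾ []           = true
isZeroᴾ (+ zero ∷ p) = isZeroᴾ p
isZeroᴾ (_ ∷ p)      = false

isZeroᴾ-sound : ∀ p K → T (isZeroᴾ p) → ⟦ p ⟧ K ≡ 0ℤ
isZeroᴾ-sound []           K _ = refl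
isZeroᴾ-sound (+ zero ∷ p) K t = begin
  ⟦ 0ℤ ∷ p ⟧ K     ≡⟨ ⟦⟧-∷ 0ℤ p K ⟩
  0ℤ + K * ⟦ p ⟧ K ≡⟨ cong (λ s → 0ℤ + K * s) (isZeroᴾ-sound p K t) ⟩
  0ℤ + K * 0ℤ      ≡⟨ ℤP.+-identityˡ (K * 0ℤ) ⟩
  K * 0ℤ           ≡⟨ ℤP.*-zeroʳ K ⟩
  0ℤ               ∎
  where open ≡-Reasoning

_==ᴾ_ : Poly → Poly → Bool
p ==ᴾ q = isZeroᴾ (p +ᴾ -ᴾ q)

==ᴾ-sound : ∀ p q K → T (p ==ᴾ q) → ⟦ p ⟧ K ≡ ⟦ q ⟧ K
==ᴾ-sound p q K t = begin
  ⟦ p ⟧ K                           ≡⟨ split (⟦ p ⟧ K) (⟦ q ⟧ K) ⟩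
  (⟦ p ⟧ K + -1ℤ * ⟦ q ⟧ K) + ⟦ q ⟧ K ≡˘⟨ cong (_+ ⟦ q ⟧ K) difference ⟩
  ⟦ p +ᴾ -ᴾ q ⟧ K + ⟦ q ⟧ K          ≡⟨ cong (_+ ⟦ q ⟧ K) (isZeroᴾ-sound (p +ᴾ -ᴾ q) K t) ⟩
  0ℤ + ⟦ q ⟧ K                      ≡⟨ ℤP.+-identityˡ (⟦ q ⟧ K) ⟩
  ⟦ q ⟧ K                           ∎
  where
  open ≡-Reasoning
  split : ∀ u v → u ≡ (u + -1ℤ * v) + v
  split = solve-∀
  difference : ⟦ p +ᴾ -ᴾ q ⟧ K ≡ ⟦ p ⟧ K + -1ℤ * ⟦ q ⟧ K
  difference = trans (⟦⟧-+ p (-ᴾ q) K) (cong (_+_ (⟦ p ⟧ K)) (⟦⟧-scale -1ℤ q K))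

-- Matrices with three special indices and k interchangeable bulk indices: an entry depends
-- only on the classes of its indices, and the bulk block is  diag · I + ones · J.

data Special : Set where
  hub leaf₁ leafₙ : Special

record Pattern (R : Set) : Set where
  constructor mkPattern
  field
    core : Special → Special → R
    row  : Special → R
    col  : Special → R
    diag : R
    ones : R
open Pattern

classSum : {R : Set} → (R → R → R) → (Special → R) → R → R
classSum _⊕_ f t = f hub ⊕ (f leaf₁ ⊕ (t ⊕ f leafₙ))

-- κ stands for the number k of bulk indices.
multiply : {R : Set} (_⊕_ _⊛_ : R → R → R) (κ : R) → Pattern R → Pattern R → Pattern R
multiply {R} _⊕_ _⊛_ κ X Y = mkPattern
  (λ x y → Σ (λ z → core X x z ⊛ core Y z y) (κ ⊛ (row X x ⊛ col Y y)))
  (λ x → Σ (λ z → core X x z ⊛ row Y z) ((row X x ⊛ diag Y) ⊕ (κ ⊛ (row X x ⊛ ones Y))))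
  (λ y → Σ (λ z → col X z ⊛ core Y z y) ((diag X ⊛ col Y y) ⊕ (κ ⊛ (ones X ⊛ col Y y))))
  (diag X ⊛ diag Y)
  (Σ (λ z → col X z ⊛ row Y z) (((diag X ⊛ ones Y) ⊕ (ones X ⊛ diag Y)) ⊕ (κ ⊛ (ones X ⊛ ones Y))))
  where
  Σ : (Special → R) → R → R
  Σ = classSum _⊕_

_·⟨_⟩_ : Pattern ℤ → ℤ → Pattern ℤ → Pattern ℤ
X ·⟨ K ⟩ Y = multiply _+_ _*_ K X Y

_·ᴾ_ : Pattern Poly → Pattern Poly → Pattern Poly
_·ᴾ_ = multiply _+ᴾ_ _*ᴾ_ Xᴾ

Pointwise : {R S : Set} → (R → S → Set) → Pattern R → Pattern S → Set
Pointwise _∼_ X Y =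
  (∀ x y → core X x y ∼ core Y x y) × (∀ x → row X x ∼ row Y x) × (∀ y → col X y ∼ col Y y) ×
  (diag X ∼ diag Y) × (ones X ∼ ones Y)

Pointwise-map : {R S : Set} {_∼_ _≃_ : R → S → Set} → (∀ {x y} → x ∼ y → x ≃ y) →
                ∀ {X Y} → Pointwise _∼_ X Y → Pointwise _≃_ X Y
Pointwise-map f (core∼ , row∼ , col∼ , diag∼ , ones∼) =
  (λ x y → f (core∼ x y)) , (λ x → f (row∼ x)) , (λ y → f (col∼ y)) , f diag∼ , f ones∼

_≋_ : Pattern ℤ → Pattern ℤ → Set
_≋_ = Pointwise _≡_

mapPattern : {R S : Set} → (R → S) → Pattern R → Pattern S
mapPattern h X = mkPattern (λ x y → h (core X x y)) (h ∘ row X) (h ∘ col X) (h (diag X)) (h (ones X))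

⟦_⟧ᵖ : Pattern Poly → ℤ → Pattern ℤ
⟦ X ⟧ᵖ K = mapPattern (λ p → ⟦ p ⟧ K) X

⟦⟧-classSum : ∀ (f g : Special → Poly) t {u} K → ⟦ t ⟧ K ≡ u →
  ⟦ classSum _+ᴾ_ (λ z → f z *ᴾ g z) t ⟧ K ≡ classSum _+_ (λ z → ⟦ f z ⟧ K * ⟦ g z ⟧ K) u
⟦⟧-classSum f g t K t≡u =
  trans (⟦⟧-+ (f hub *ᴾ g hub) _ K) (cong₂ _+_ (⟦⟧-* (f hub) (g hub) K)
  (trans (⟦⟧-+ (f leaf₁ *ᴾ g leaf₁) _ K) (cong₂ _+_ (⟦⟧-* (f leaf₁) (g leaf₁) K)
  (trans (⟦⟧-+ t _ K) (cong₂ _+_ t≡u (⟦⟧-* (f leafₙ) (g leafₙ) K))))))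

⟦⟧-X* : ∀ p q K → ⟦ Xᴾ *ᴾ (p *ᴾ q) ⟧ K ≡ K * (⟦ p ⟧ K * ⟦ q ⟧ K)
⟦⟧-X* p q K = trans (⟦⟧-* Xᴾ (p *ᴾ q) K) (cong₂ _*_ (⟦X⟧ K) (⟦⟧-* p q K))

⟦⟧-· : ∀ X Y K → ⟦ X ·ᴾ Y ⟧ᵖ K ≋ (⟦ X ⟧ᵖ K ·⟨ K ⟩ ⟦ Y ⟧ᵖ K)
⟦⟧-· X Y K =
  (λ x y → ⟦⟧-classSum (core X x) (λ z → core Y z y) _ K (⟦⟧-X* (row X x) (col Y y) K)) ,
  (λ x → ⟦⟧-classSum (core X x) (row Y) _ K
           (trans (⟦⟧-+ (row X x *ᴾ diag Y) _ K)
                  (cong₂ _+_ (⟦⟧-* (row X x) (diag Y) K) (⟦⟧-X* (row X x) (ones Y) K)))) ,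
  (λ y → ⟦⟧-classSum (col X) (λ z → core Y z y) _ K
           (trans (⟦⟧-+ (diag X *ᴾ col Y y) _ K)
                  (cong₂ _+_ (⟦⟧-* (diag X) (col Y y) K) (⟦⟧-X* (ones X) (col Y y) K)))) ,
  ⟦⟧-* (diag X) (diag Y) K ,
  ⟦⟧-classSum (col X) (row Y) _ K
    (trans (⟦⟧-+ (diag X *ᴾ ones Y +ᴾ ones X *ᴾ diag Y) _ K)
      (cong₂ _+_ (trans (⟦⟧-+ (diag X *ᴾ ones Y) _ K)
                        (cong₂ _+_ (⟦⟧-* (diag X) (ones Y) K) (⟦⟧-* (ones X) (diag Y) K)))
                 (⟦⟧-X* (ones X) (ones Y) K)))

zipPattern : {R : Set} → (R → R → R) → Pattern R → Pattern R → Pattern R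
zipPattern _⊕_ X Y = mkPattern (λ x y → core X x y ⊕ core Y x y) (λ x → row X x ⊕ row Y x)
  (λ y → col X y ⊕ col Y y) (diag X ⊕ diag Y) (ones X ⊕ ones Y)

⟦⟧-zip : ∀ X Y K → ⟦ zipPattern _+ᴾ_ X Y ⟧ᵖ K ≋ zipPattern _+_ (⟦ X ⟧ᵖ K) (⟦ Y ⟧ᵖ K)
⟦⟧-zip X Y K = (λ x y → ⟦⟧-+ (core X x y) _ K) , (λ x → ⟦⟧-+ (row X x) _ K) ,
               (λ y → ⟦⟧-+ (col X y) _ K) , ⟦⟧-+ (diag X) _ K , ⟦⟧-+ (ones X) _ K

constᴾ : Pattern ℤ → Pattern Poly
constᴾ = mapPattern (_∷ [])

allSpecial : (Special → Bool) → Bool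
allSpecial f = f hub ∧ (f leaf₁ ∧ f leafₙ)

∧-split : ∀ x {y} → T (x ∧ y) → T x × T y
∧-split x = Equivalence.to (T-∧ {x})

allSpecial-sound : ∀ f → T (allSpecial f) → ∀ z → T (f z)
allSpecial-sound f t hub   = proj₁ (∧-split (f hub) t)
allSpecial-sound f t leaf₁ = proj₁ (∧-split (f leaf₁) (proj₂ (∧-split (f hub) t)))
allSpecial-sound f t leafₙ = proj₂ (∧-split (f leaf₁) (proj₂ (∧-split (f hub) t)))

allPointwise : {R : Set} → (R → R → Bool) → Pattern R → Pattern R → Bool
allPointwise b X Y =
  allSpecial (λ x → allSpecial (λ y → b (core X x y) (core Y x y))) ∧
  (allSpecial (λ x → b (row X x) (row Y x)) ∧ (allSpecial (λ y → b (col X y) (col Y y)) ∧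
  (b (diag X) (diag Y) ∧ b (ones X) (ones Y))))

allPointwise-sound : {R : Set} (b : R → R → Bool) (X Y : Pattern R) →
                     T (allPointwise b X Y) → Pointwise (λ x y → T (b x y)) X Y
allPointwise-sound b X Y t =
  (λ x y → allSpecial-sound (λ y → b (core X x y) (core Y x y))
             (allSpecial-sound cores (proj₁ core-rest) x) y) ,
  allSpecial-sound rows (proj₁ row-rest) ,
  allSpecial-sound cols (proj₁ col-rest) ,
  ∧-split (b (diag X) (diag Y)) (proj₂ col-rest)
  where
  cores : Special → Bool
  cores x = allSpecial (λ y → b (core X x y) (core Y x y))
  rows cols : Special → Bool
  rows x = b (row X x) (row Y x)
  cols y = b (col X y) (col Y y)
  scalars : Bool
  scalars = b (diag X) (diag Y) ∧ b (ones X) (ones Y)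
  core-rest : T (allSpecial cores) × T (allSpecial rows ∧ (allSpecial cols ∧ scalars))
  core-rest = ∧-split (allSpecial cores) t
  row-rest : T (allSpecial rows) × T (allSpecial cols ∧ scalars)
  row-rest = ∧-split (allSpecial rows) (proj₂ core-rest)
  col-rest : T (allSpecial cols) × T scalars
  col-rest = ∧-split (allSpecial cols) (proj₂ row-rest)

_==ᵖ_ : Pattern Poly → Pattern Poly → Bool
_==ᵖ_ = allPointwise _==ᴾ_

==ᵖ-sound : ∀ X Y → T (X ==ᵖ Y) → ∀ K → ⟦ X ⟧ᵖ K ≋ ⟦ Y ⟧ᵖ K
==ᵖ-sound X Y t K = Pointwise-map (λ {p} {q} → ==ᴾ-sound p q K) {X} {Y} (allPointwise-sound _==ᴾ_ X Y t)

data Class (k : ℕ) : Set where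
  special : Special → Class k
  bulk    : Fin k → Class k

lastOrBulk : ∀ {k} {i : Fin (suc k)} → Top.View i → Class k
lastOrBulk Top.‵fromℕ        = special leafₙ
lastOrBulk (Top.‵inject₁ j) = bulk j

-- Index 0 is the hub, 1 the first leaf, 2, …, k + 1 the bulk and k + 2 the last leaf.
classOf : ∀ {k} → Fin (3 ℕ.+ k) → Class k
classOf zero          = special hub
classOf (suc zero)    = special leaf₁
classOf (suc (suc i)) = lastOrBulk (Top.view i)

classOf-bulk : ∀ {k} (j : Fin k) → classOf (suc (suc (inject₁ j))) ≡ bulk j
classOf-bulk j rewrite Top.view-inject₁ j = refl

classOf-last : ∀ k → classOf (suc (suc (fromℕ k))) ≡ special leafₙ
classOf-last k rewrite Top.view-fromℕ k = refl

data Position {k} : Fin (3 ℕ.+ k) → Set where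
  at-hub   : Position zero
  at-leaf₁ : Position (suc zero)
  at-bulk  : (j : Fin k) → Position (suc (suc (inject₁ j)))
  at-leafₙ : Position (suc (suc (fromℕ k)))

position : ∀ {k} (i : Fin (3 ℕ.+ k)) → Position i
position zero          = at-hub
position (suc zero)    = at-leaf₁
position (suc (suc i)) with Top.view i
... | Top.‵fromℕ       = at-leafₙ
... | Top.‵inject₁ j  = at-bulk j

entry : ∀ {k} → Pattern ℤ → Class k → Class k → ℤ
entry X (special x) (special y) = core X x y
entry X (special x) (bulk _)    = row X x
entry X (bulk _)    (special y) = col X y
entry X (bulk x)    (bulk y)    = diag X * δ x y + ones X

matrix : ∀ {k} → Pattern ℤ → Mat (3 ℕ.+ k) (3 ℕ.+ k)
matrix X i j = entry X (classOf i) (classOf j)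

matrix-cong : ∀ {k X Y} → X ≋ Y → matrix {k} X ≈M matrix Y
matrix-cong {X = X} {Y} (core≡ , row≡ , col≡ , diag≡ , ones≡) i j = entry-cong (classOf i) (classOf j)
  where
  entry-cong : ∀ c c′ → entry X c c′ ≡ entry Y c c′
  entry-cong (special x) (special y) = core≡ x y
  entry-cong (special x) (bulk _)    = row≡ x
  entry-cong (bulk _)    (special y) = col≡ y
  entry-cong (bulk x)    (bulk y)    = cong₂ (λ d o → d * δ x y + o) diag≡ ones≡

classSum-congʳ : ∀ (f : Special → ℤ) {t u} → t ≡ u → classSum _+_ f t ≡ classSum _+_ f u
classSum-congʳ f = cong (classSum _+_ f)

Σℤ-classes : ∀ {k} (G : Class k → ℤ) → Σℤ (G ∘ classOf) ≡ classSum _+_ (G ∘ special) (Σℤ (G ∘ bulk))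
Σℤ-classes {k} G = cong (λ s → G (special hub) + (G (special leaf₁) + s)) (begin
  Σℤ (λ i → G (classOf (suc (suc i))))
    ≡⟨ Σℤ-init-last (λ i → G (classOf (suc (suc i)))) ⟩
  Σℤ (λ j → G (classOf (suc (suc (inject₁ j))))) + G (classOf (suc (suc (fromℕ k))))
    ≡⟨ cong₂ _+_ (Σℤ-cong (cong G ∘ classOf-bulk)) (cong G (classOf-last k)) ⟩
  Σℤ (G ∘ bulk) + G (special leafₙ) ∎)
  where open ≡-Reasoning

entry-· : ∀ {k} X Y (c c′ : Class k) →
  classSum _+_ (λ z → entry X c (special z) * entry Y (special z) c′)
               (Σℤ (λ j → entry X c (bulk j) * entry Y (bulk j) c′))
    ≡ entry (X ·⟨ + k ⟩ Y) c c′
entry-· {k} X Y (special x) (special y) =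
  classSum-congʳ (λ z → core X x z * core Y z y) (Σℤ-const {k} (row X x * col Y y))
entry-· {k} X Y (special x) (bulk y) =
  classSum-congʳ (λ z → core X x z * row Y z) (Σℤ-row y (row X x) (diag Y) (ones Y))
entry-· {k} X Y (bulk x) (special y) =
  classSum-congʳ (λ z → col X z * core Y z y) (Σℤ-col x (col Y y) (diag X) (ones X))
entry-· {k} X Y (bulk x) (bulk y) = begin
  classSum _+_ (λ z → col X z * row Y z) (Σℤ (λ j → (diag X * δ x j + ones X) * (diag Y * δ j y + ones Y)))
    ≡⟨ classSum-congʳ (λ z → col X z * row Y z) (Σℤ-block x y (diag X) (ones X) (diag Y) (ones Y)) ⟩
  classSum _+_ (λ z → col X z * row Y z) ((diag X * diag Y) * δ x y + bulkOnes)
    ≡⟨ pull-out (col X hub * row Y hub) (col X leaf₁ * row Y leaf₁) ((diag X * diag Y) * δ x y)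
                bulkOnes (col X leafₙ * row Y leafₙ) ⟩
  (diag X * diag Y) * δ x y + classSum _+_ (λ z → col X z * row Y z) bulkOnes ∎
  where
  open ≡-Reasoning
  bulkOnes : ℤ
  bulkOnes = (diag X * ones Y + ones X * diag Y) + + k * (ones X * ones Y)
  pull-out : ∀ a b e t c → a + (b + ((e + t) + c)) ≡ e + (a + (b + (t + c)))
  pull-out = solve-∀

matrix-· : ∀ {k} X Y → (matrix {k} X ⊗ matrix Y) ≈M matrix (X ·⟨ + k ⟩ Y)
matrix-· X Y i j =
  trans (Σℤ-classes (λ c → entry X (classOf i) c * entry Y c (classOf j)))
        (entry-· X Y (classOf i) (classOf j))

matrix-zip : ∀ {k} X Y (i j : Fin (3 ℕ.+ k)) → matrix (zipPattern _+_ X Y) i j ≡ matrix X i j + matrix Y i j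
matrix-zip X Y i j = entry-zip (classOf i) (classOf j)
  where
  entry-zip : ∀ c c′ → entry (zipPattern _+_ X Y) c c′ ≡ entry X c c′ + entry Y c c′
  entry-zip (special _) (special _) = refl
  entry-zip (special _) (bulk _)    = refl
  entry-zip (bulk _)    (special _) = refl
  entry-zip (bulk x)    (bulk y)    = distribute (diag X) (diag Y) (δ x y) (ones X) (ones Y)
    where
    distribute : ∀ d d′ e o o′ → (d + d′) * e + (o + o′) ≡ (d * e + o) + (d′ * e + o′)
    distribute = solve-∀

δˢ : Special → Special → ℤ
δˢ hub   hub   = 1ℤ
δˢ leaf₁ leaf₁ = 1ℤ
δˢ leafₙ leafₙ = 1ℤ
δˢ _     _     = 0ℤ

δᶜ : ∀ {k} → Class k → Class k → ℤ
δᶜ (special x) (special y) = δˢ x y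
δᶜ (special _) (bulk _)    = 0ℤ
δᶜ (bulk _)    (special _) = 0ℤ
δᶜ (bulk x)    (bulk y)    = δ x y

isHubˢ : Special → Bool
isHubˢ hub = true
isHubˢ _   = false

isHub : ∀ {k} → Class k → Bool
isHub (special x) = isHubˢ x
isHub (bulk _)    = false

classwise : ∀ {k} → (Special → ℤ) → ℤ → Class k → ℤ
classwise f β (special x) = f x
classwise f β (bulk _)    = β

δ-classOf : ∀ {k} (i j : Fin (3 ℕ.+ k)) → δ i j ≡ δᶜ (classOf i) (classOf j)
δ-classOf {k} i j with position i | position j
... | at-hub    | at-hub    = refl
... | at-hub    | at-leaf₁  = refl
... | at-hub    | at-bulk y rewrite classOf-bulk y = refl
... | at-hub    | at-leafₙ  rewrite classOf-last k = refl
... | at-leaf₁  | at-hub    = refl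
... | at-leaf₁  | at-leaf₁  = refl
... | at-leaf₁  | at-bulk y rewrite classOf-bulk y = refl
... | at-leaf₁  | at-leafₙ  rewrite classOf-last k = refl
... | at-bulk x | at-hub    rewrite classOf-bulk x = refl
... | at-bulk x | at-leaf₁  rewrite classOf-bulk x = refl
... | at-bulk x | at-bulk y rewrite classOf-bulk x | classOf-bulk y = δ-inject₁ x y
... | at-bulk x | at-leafₙ  rewrite classOf-bulk x | classOf-last k = δ-inject₁-fromℕ x
... | at-leafₙ  | at-hub    rewrite classOf-last k = refl
... | at-leafₙ  | at-leaf₁  rewrite classOf-last k = refl
... | at-leafₙ  | at-bulk y rewrite classOf-last k | classOf-bulk y = trans (δ-sym (fromℕ k) (inject₁ y)) (δ-inject₁-fromℕ y)
... | at-leafₙ  | at-leafₙ  rewrite classOf-last k = δ-refl (fromℕ k)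

isHub-classOf : ∀ {k} (i : Fin (3 ℕ.+ k)) → isHub (classOf i) ≡ isZero i
isHub-classOf {k} i with position i
... | at-hub    = refl
... | at-leaf₁  = refl
... | at-bulk j rewrite classOf-bulk j = refl
... | at-leafₙ  rewrite classOf-last k = refl

diagonalPattern : (Special → ℤ) → ℤ → Pattern ℤ
diagonalPattern f β = mkPattern (λ x y → δˢ x y * f x) (λ _ → 0ℤ) (λ _ → 0ℤ) β 0ℤ

diagonalᴾ : (Special → Poly) → Poly → Pattern Poly
diagonalᴾ f β = mkPattern (λ x y → (δˢ x y ∷ []) *ᴾ f x) (λ _ → []) (λ _ → []) β []

⟦⟧-diagonal : ∀ f β K → ⟦ diagonalᴾ f β ⟧ᵖ K ≋ diagonalPattern (λ x → ⟦ f x ⟧ K) (⟦ β ⟧ K)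
⟦⟧-diagonal f β K = (λ x y → ⟦⟧-* (δˢ x y ∷ []) (f x) K) , (λ _ → refl) , (λ _ → refl) , refl , refl

matrix-diagonal : ∀ {k} f β (i j : Fin (3 ℕ.+ k)) →
  δ i j * classwise f β (classOf i) ≡ matrix (diagonalPattern f β) i j
matrix-diagonal f β i j =
  trans (cong (_* classwise f β (classOf i)) (δ-classOf i j)) (entry-diagonal (classOf i) (classOf j))
  where
  entry-diagonal : ∀ c c′ → δᶜ c c′ * classwise f β c ≡ entry (diagonalPattern f β) c c′
  entry-diagonal (special _) (special _) = refl
  entry-diagonal (special _) (bulk _)    = refl
  entry-diagonal (bulk _)    (special _) = refl
  entry-diagonal (bulk x)    (bulk y)    = commute (δ x y) β
    where
    commute : ∀ e b → e * b ≡ b * e + 0ℤ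
    commute = solve-∀

adjacencyPattern : ℤ → Pattern ℤ
adjacencyPattern e = mkPattern (λ x y → e * b2ℤ (isHubˢ x xor isHubˢ y)) (λ x → e * b2ℤ (isHubˢ x))
  (λ y → e * b2ℤ (isHubˢ y)) 0ℤ 0ℤ

matrix-adjacency : ∀ {k} e (i j : Fin (3 ℕ.+ k)) →
  e * adjMat (star (2 ℕ.+ k)) i j ≡ matrix (adjacencyPattern e) i j
matrix-adjacency e i j = begin
  e * b2ℤ (star _ i j)                                ≡⟨ cong (λ b → e * b2ℤ b) (star-isZero i j) ⟩
  e * b2ℤ (isZero i xor isZero j)                     ≡˘⟨ cong₂ (λ b b′ → e * b2ℤ (b xor b′)) (isHub-classOf i) (isHub-classOf j) ⟩
  e * b2ℤ (isHub (classOf i) xor isHub (classOf j))   ≡⟨ entry-adjacency (classOf i) (classOf j) ⟩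
  matrix (adjacencyPattern e) i j                     ∎
  where
  open ≡-Reasoning
  entry-adjacency : ∀ {k} (c c′ : Class k) → e * b2ℤ (isHub c xor isHub c′) ≡ entry (adjacencyPattern e) c c′
  entry-adjacency (special _) (special _) = refl
  entry-adjacency (special x) (bulk _)    = cong (λ b → e * b2ℤ b) (xor-identityʳ (isHubˢ x))
  entry-adjacency (bulk _)    (special _) = refl
  entry-adjacency (bulk x)    (bulk y)    = trans (ℤP.*-zeroʳ e) (sym (ℤP.+-identityʳ (0ℤ * δ x y)))

-- In the variable K = k = n − 2 these are n, n − 1, the leaf transmission 2n − 1, 2n(n − 1)
-- and the last invariant factor 2n(n − 1)(2n − 1).
nᴾ n∸1ᴾ mᴾ tᴾ bigᴾ : Poly
nᴾ   = + 2 ∷ + 1 ∷ []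
n∸1ᴾ = + 1 ∷ + 1 ∷ []
mᴾ   = + 3 ∷ + 2 ∷ []
tᴾ   = (+ 2 ∷ []) *ᴾ (nᴾ *ᴾ n∸1ᴾ)
bigᴾ = tᴾ *ᴾ mᴾ

⟦affine⟧ : ∀ c a k → + (c ℕ.+ k ℕ.* a) ≡ ⟦ + c ∷ + a ∷ [] ⟧ (+ k)
⟦affine⟧ c a k = trans (ℤP.pos-+ c (k ℕ.* a)) (cong (_+_ (+ c)) (ℤP.pos-* k a))

⟦c+X⟧ : ∀ c k → + (c ℕ.+ k) ≡ ⟦ + c ∷ + 1 ∷ [] ⟧ (+ k)
⟦c+X⟧ c k = trans (cong (λ x → + (c ℕ.+ x)) (sym (ℕP.*-identityʳ k))) (⟦affine⟧ c 1 k)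

⟦mᴾ⟧ : ∀ k → + suc (2 ℕ.* suc k) ≡ ⟦ mᴾ ⟧ (+ k)
⟦mᴾ⟧ k = trans (cong +_ (affine k)) (⟦affine⟧ 3 2 k)
  where
  affine : ∀ k → suc (2 ℕ.* suc k) ≡ 3 ℕ.+ k ℕ.* 2
  affine = ℕSolver.solve-∀

2n∸1 : ∀ k → 2 ℕ.* (2 ℕ.+ k) ℕ.∸ 1 ≡ suc (2 ℕ.* suc k)
2n∸1 k = cong (ℕ._∸ 1) (ℕP.*-suc 2 (suc k))

⟦bigᴾ⟧ : ∀ k → + (2 ℕ.* (2 ℕ.+ k) ℕ.* suc k ℕ.* (2 ℕ.* (2 ℕ.+ k) ℕ.∸ 1)) ≡ ⟦ bigᴾ ⟧ (+ k)
⟦bigᴾ⟧ k = begin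
  + (2 ℕ.* n ℕ.* suc k ℕ.* (2 ℕ.* n ℕ.∸ 1))
    ≡⟨ cong (λ m → + (2 ℕ.* n ℕ.* suc k ℕ.* m)) (2n∸1 k) ⟩
  + (2 ℕ.* n ℕ.* suc k ℕ.* suc (2 ℕ.* suc k))
    ≡⟨ pos-*⁴ 2 n (suc k) (suc (2 ℕ.* suc k)) ⟩
  + 2 * + n * + suc k * + suc (2 ℕ.* suc k)
    ≡⟨ cong₂ (λ a b → + 2 * a * b * + suc (2 ℕ.* suc k)) (⟦c+X⟧ 2 k) (⟦c+X⟧ 1 k) ⟩
  + 2 * ⟦ nᴾ ⟧ K * ⟦ n∸1ᴾ ⟧ K * + suc (2 ℕ.* suc k)
    ≡⟨ cong (λ a → + 2 * ⟦ nᴾ ⟧ K * ⟦ n∸1ᴾ ⟧ K * a) (⟦mᴾ⟧ k) ⟩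
  + 2 * ⟦ nᴾ ⟧ K * ⟦ n∸1ᴾ ⟧ K * ⟦ mᴾ ⟧ K
    ≡⟨ reassociate (+ 2) (⟦ nᴾ ⟧ K) (⟦ n∸1ᴾ ⟧ K) (⟦ mᴾ ⟧ K) ⟩
  (+ 2 * (⟦ nᴾ ⟧ K * ⟦ n∸1ᴾ ⟧ K)) * ⟦ mᴾ ⟧ K
    ≡˘⟨ cong (_* ⟦ mᴾ ⟧ K) (trans (⟦⟧-* (+ 2 ∷ []) (nᴾ *ᴾ n∸1ᴾ) K) (cong (+ 2 *_) (⟦⟧-* nᴾ n∸1ᴾ K))) ⟩
  ⟦ tᴾ ⟧ K * ⟦ mᴾ ⟧ K
    ≡˘⟨ ⟦⟧-* tᴾ mᴾ K ⟩
  ⟦ bigᴾ ⟧ K ∎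
  where
  open ≡-Reasoning
  n : ℕ
  n = 2 ℕ.+ k
  K : ℤ
  K = + k
  pos-*⁴ : ∀ a b c d → + (a ℕ.* b ℕ.* c ℕ.* d) ≡ + a * + b * + c * + d
  pos-*⁴ a b c d = trans (ℤP.pos-* (a ℕ.* b ℕ.* c) d)
    (cong (_* + d) (trans (ℤP.pos-* (a ℕ.* b) c) (cong (_* + c) (ℤP.pos-* a b))))
  reassociate : ∀ a b c d → a * b * c * d ≡ (a * (b * c)) * d
  reassociate = solve-∀

trsᴾ snfᴾ : Special → Poly
trsᴾ hub = nᴾ
trsᴾ _   = mᴾ
snfᴾ leafₙ = bigᴾ
snfᴾ _     = 1ᴾ

Iᴾ Dᴾ : Pattern Poly
Iᴾ = diagonalᴾ (λ _ → 1ᴾ) 1ᴾ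
Dᴾ = diagonalᴾ snfᴾ mᴾ

-- diag(trs) + e · adjacency, so A^trs is the case e = −1 and A^trs_+ the case e = 1.
Aᴾ : ℤ → Pattern Poly
Aᴾ e = zipPattern _+ᴾ_ (diagonalᴾ trsᴾ mᴾ) (constᴾ (adjacencyPattern e))

Pᴾ P⁻¹ᴾ Qᴾ Q⁻¹ᴾ : ℤ → Pattern Poly
Pᴾ e = mkPattern
  (λ { hub leaf₁ → e ∷ [] ; leaf₁ hub → e ∷ [] ; leaf₁ leaf₁ → -ᴾ nᴾ ; leafₙ hub → scaleᴾ (- e) mᴾ
     ; leafₙ leaf₁ → mᴾ *ᴾ nᴾ +ᴾ -ᴾ n∸1ᴾ ; leafₙ leafₙ → 1ᴾ ; _ _ → [] })
  (λ { leafₙ → 1ᴾ ; _ → [] }) (λ { leaf₁ → -1ℤ ∷ [] ; _ → [] }) 1ᴾ []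
P⁻¹ᴾ e = mkPattern
  (λ { hub hub → nᴾ ; hub leaf₁ → e ∷ [] ; leaf₁ hub → e ∷ [] ; leafₙ hub → e ∷ []
     ; leafₙ leaf₁ → mᴾ ; leafₙ leafₙ → 1ᴾ ; _ _ → [] })
  (λ { leafₙ → -1ℤ ∷ [] ; _ → [] }) (λ { hub → e ∷ [] ; _ → [] }) 1ᴾ []
Qᴾ e = mkPattern
  (λ { hub hub → 1ᴾ ; leafₙ leaf₁ → 1ᴾ ; leaf₁ leafₙ → 1ᴾ ; hub leafₙ → scaleᴾ (- e) mᴾ
     ; leafₙ leafₙ → tᴾ +ᴾ 1ᴾ ; _ _ → [] })
  (λ { leafₙ → -1ℤ ∷ [] ; _ → [] }) (λ { leafₙ → 1ᴾ ; _ → [] }) 1ᴾ []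
Q⁻¹ᴾ e = mkPattern
  (λ { hub hub → 1ᴾ ; hub leaf₁ → scaleᴾ e mᴾ ; leaf₁ leaf₁ → -ᴾ (tᴾ +ᴾ n∸1ᴾ) ; leaf₁ leafₙ → 1ᴾ
     ; leafₙ leaf₁ → 1ᴾ ; _ _ → [] })
  (λ { leaf₁ → 1ᴾ ; _ → [] }) (λ { leaf₁ → -1ℤ ∷ [] ; _ → [] }) 1ᴾ []

record Certificate (e : ℤ) : Set where
  field
    PAQ≡D  : T (((Pᴾ e ·ᴾ Aᴾ e) ·ᴾ Qᴾ e) ==ᵖ Dᴾ)
    PP⁻¹≡I : T ((Pᴾ e ·ᴾ P⁻¹ᴾ e) ==ᵖ Iᴾ)
    P⁻¹P≡I : T ((P⁻¹ᴾ e ·ᴾ Pᴾ e) ==ᵖ Iᴾ)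
    QQ⁻¹≡I : T ((Qᴾ e ·ᴾ Q⁻¹ᴾ e) ==ᵖ Iᴾ)
    Q⁻¹Q≡I : T ((Q⁻¹ᴾ e ·ᴾ Qᴾ e) ==ᵖ Iᴾ)

certificate⁻ : Certificate -1ℤ
certificate⁻ = record { PAQ≡D = tt ; PP⁻¹≡I = tt ; P⁻¹P≡I = tt ; QQ⁻¹≡I = tt ; Q⁻¹Q≡I = tt }

certificate⁺ : Certificate 1ℤ
certificate⁺ = record { PAQ≡D = tt ; PP⁻¹≡I = tt ; P⁻¹P≡I = tt ; QQ⁻¹≡I = tt ; Q⁻¹Q≡I = tt }

diagonal-isSmithForm : ∀ {N} (f : ℕ → ℕ) → (∀ t → suc t ℕ.< N → f t ℕD.∣ f (suc t)) →
                       IsSmithForm {N} (λ i j → δ i j * + f (toℕ i))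
diagonal-isSmithForm {N} f chain =
  (λ i j i≢j → cong (_* + f (toℕ i)) (δ-≢ i j i≢j)) ,
  (λ i → subst (0ℤ ℤ.≤_) (sym (diagonal-entry i)) (ℤ.+≤+ z≤n)) ,
  (λ i j j≡1+i → subst₂ (λ a b → ℤ.∣ a ∣ ℕD.∣ ℤ.∣ b ∣) (sym (diagonal-entry i)) (sym (diagonal-entry j))
                   (subst (λ t → f (toℕ i) ℕD.∣ f t) (sym j≡1+i)
                     (chain (toℕ i) (subst (ℕ._< N) j≡1+i (FinP.toℕ<n j)))))
  where
  diagonal-entry : ∀ i → δ i i * + f (toℕ i) ≡ + f (toℕ i)
  diagonal-entry i = trans (cong (_* + f (toℕ i)) (δ-refl i)) (ℤP.*-identityˡ _)

starSNFentry-∣ : ∀ n t → suc t ℕ.< suc n → starSNFentry n t ℕD.∣ starSNFentry n (suc t)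
starSNFentry-∣ n zero          _          = 1∣ _
starSNFentry-∣ n (suc zero)    _          = 1∣ _
starSNFentry-∣ n (suc (suc t)) (s≤s 3+t≤n) with suc (suc t) ℕ.≟ n
... | yes 2+t≡n = ⊥-elim (ℕP.<-irrefl 2+t≡n 3+t≤n)
... | no  _ with suc (suc (suc t)) ℕ.≟ n
...   | yes _ = divides (2 ℕ.* n ℕ.* (n ℕ.∸ 1)) refl
...   | no  _ = ∣-refl

starSNF-isSmithForm : ∀ n → IsSmithForm (starSNF n)
starSNF-isSmithForm n = diagonal-isSmithForm (starSNFentry n) (starSNFentry-∣ n)

matrix-diagonalᴾ : ∀ {k} f β (g : Fin (3 ℕ.+ k) → ℤ) →
  (∀ i → g i ≡ classwise (λ x → ⟦ f x ⟧ (+ k)) (⟦ β ⟧ (+ k)) (classOf i)) →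
  (λ i j → δ i j * g i) ≈M matrix (⟦ diagonalᴾ f β ⟧ᵖ (+ k))
matrix-diagonalᴾ {k} f β g g-classwise i j = begin
  δ i j * g i
    ≡⟨ cong (δ i j *_) (g-classwise i) ⟩
  δ i j * classwise (λ x → ⟦ f x ⟧ (+ k)) (⟦ β ⟧ (+ k)) (classOf i)
    ≡⟨ matrix-diagonal (λ x → ⟦ f x ⟧ (+ k)) (⟦ β ⟧ (+ k)) i j ⟩
  matrix (diagonalPattern (λ x → ⟦ f x ⟧ (+ k)) (⟦ β ⟧ (+ k))) i j
    ≡˘⟨ matrix-cong (⟦⟧-diagonal f β (+ k)) i j ⟩
  matrix (⟦ diagonalᴾ f β ⟧ᵖ (+ k)) i j ∎
  where open ≡-Reasoning

classwise-const : ∀ {k} b (c : Class k) → classwise (λ _ → b) b c ≡ b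
classwise-const b (special _) = refl
classwise-const b (bulk _)    = refl

identity-matrix : ∀ k → I ≈M matrix {k} (⟦ Iᴾ ⟧ᵖ (+ k))
identity-matrix k i j =
  trans (sym (ℤP.*-identityʳ (δ i j)))
        (matrix-diagonalᴾ (λ _ → 1ᴾ) 1ᴾ (λ _ → 1ℤ) (λ i → sym (classwise-const 1ℤ (classOf i))) i j)

starSNFentry-middle : ∀ n t → suc (suc t) ≢ n → starSNFentry n (suc (suc t)) ≡ 2 ℕ.* n ℕ.∸ 1
starSNFentry-middle n t 2+t≢n with suc (suc t) ℕ.≟ n
... | yes 2+t≡n = ⊥-elim (2+t≢n 2+t≡n)
... | no  _     = refl

starSNFentry-last : ∀ k → let n = 2 ℕ.+ k in starSNFentry n n ≡ 2 ℕ.* n ℕ.* (n ℕ.∸ 1) ℕ.* (2 ℕ.* n ℕ.∸ 1)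
starSNFentry-last k with suc (suc k) ℕ.≟ suc (suc k)
... | yes _   = refl
... | no  n≢n = ⊥-elim (n≢n refl)

snf-classwise : ∀ k (i : Fin (3 ℕ.+ k)) →
  + starSNFentry (2 ℕ.+ k) (toℕ i) ≡ classwise (λ x → ⟦ snfᴾ x ⟧ (+ k)) (⟦ mᴾ ⟧ (+ k)) (classOf i)
snf-classwise k i with position i
... | at-hub    = refl
... | at-leaf₁  = refl
... | at-bulk j rewrite classOf-bulk j | FinP.toℕ-inject₁ j =
  begin
    + starSNFentry (2 ℕ.+ k) (2 ℕ.+ toℕ j)
      ≡⟨ cong +_ (starSNFentry-middle (2 ℕ.+ k) (toℕ j) (ℕP.<⇒≢ (s≤s (s≤s (FinP.toℕ<n j))))) ⟩
    + (2 ℕ.* (2 ℕ.+ k) ℕ.∸ 1)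
      ≡⟨ cong +_ (2n∸1 k) ⟩
    + suc (2 ℕ.* suc k)
      ≡⟨ ⟦mᴾ⟧ k ⟩
    ⟦ mᴾ ⟧ (+ k) ∎
  where open ≡-Reasoning
... | at-leafₙ  rewrite classOf-last k | FinP.toℕ-fromℕ k =
  trans (cong +_ (starSNFentry-last k)) (⟦bigᴾ⟧ k)

snf-matrix : ∀ k → starSNF (2 ℕ.+ k) ≈M matrix (⟦ Dᴾ ⟧ᵖ (+ k))
snf-matrix k = matrix-diagonalᴾ snfᴾ mᴾ _ (snf-classwise k)

trs-classwise : ∀ k {d} → IsDistance (star (2 ℕ.+ k)) d → ∀ (i : Fin (3 ℕ.+ k)) →
  + trs d i ≡ classwise (λ x → ⟦ trsᴾ x ⟧ (+ k)) (⟦ mᴾ ⟧ (+ k)) (classOf i)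
trs-classwise k isDist i with position i
... | at-hub    = trans (cong +_ (trs-hub isDist)) (⟦c+X⟧ 2 k)
... | at-leaf₁  = trans (cong +_ (trs-leaf isDist zero)) (⟦mᴾ⟧ k)
... | at-bulk j rewrite classOf-bulk j = trans (cong +_ (trs-leaf isDist (suc (inject₁ j)))) (⟦mᴾ⟧ k)
... | at-leafₙ  rewrite classOf-last k = trans (cong +_ (trs-leaf isDist (suc (fromℕ k)))) (⟦mᴾ⟧ k)

matrix-Aᴾ : ∀ k e {d} → IsDistance (star (2 ℕ.+ k)) d →
  (λ i j → diagTrs d i j + e * adjMat (star (2 ℕ.+ k)) i j) ≈M matrix (⟦ Aᴾ e ⟧ᵖ (+ k))
matrix-Aᴾ k e {d} isDist i j = begin
  diagTrs d i j + e * adjMat (star (2 ℕ.+ k)) i j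
    ≡⟨ cong₂ _+_ (matrix-diagonalᴾ trsᴾ mᴾ _ (trs-classwise k isDist) i j) (matrix-adjacency e i j) ⟩
  matrix Tr i j + matrix (⟦ constᴾ (adjacencyPattern e) ⟧ᵖ (+ k)) i j
    ≡˘⟨ matrix-zip Tr (⟦ constᴾ (adjacencyPattern e) ⟧ᵖ (+ k)) i j ⟩
  matrix (zipPattern _+_ Tr (⟦ constᴾ (adjacencyPattern e) ⟧ᵖ (+ k))) i j
    ≡˘⟨ matrix-cong (⟦⟧-zip (diagonalᴾ trsᴾ mᴾ) (constᴾ (adjacencyPattern e)) (+ k)) i j ⟩
  matrix (⟦ Aᴾ e ⟧ᵖ (+ k)) i j ∎
  where
  open ≡-Reasoning
  Tr : Pattern ℤ
  Tr = ⟦ diagonalᴾ trsᴾ mᴾ ⟧ᵖ (+ k)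

module _ (k : ℕ) {e : ℤ} (certificate : Certificate e) where
  open Certificate certificate

  ⟪_⟫ : Pattern Poly → Mat (3 ℕ.+ k) (3 ℕ.+ k)
  ⟪ X ⟫ = matrix (⟦ X ⟧ᵖ (+ k))

  ⟪⟫-· : ∀ X Y → (⟪ X ⟫ ⊗ ⟪ Y ⟫) ≈M ⟪ X ·ᴾ Y ⟫
  ⟪⟫-· X Y i j = trans (matrix-· (⟦ X ⟧ᵖ (+ k)) (⟦ Y ⟧ᵖ (+ k)) i j) (sym (matrix-cong (⟦⟧-· X Y (+ k)) i j))

  ⟪⟫-certified : ∀ X Y → T (X ==ᵖ Y) → ⟪ X ⟫ ≈M ⟪ Y ⟫
  ⟪⟫-certified X Y X==Y = matrix-cong (==ᵖ-sound X Y X==Y (+ k))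

  ⟪⟫-inverse : ∀ X Y → T ((X ·ᴾ Y) ==ᵖ Iᴾ) → (⟪ X ⟫ ⊗ ⟪ Y ⟫) ≈M I
  ⟪⟫-inverse X Y XY==I i j =
    trans (⟪⟫-· X Y i j) (trans (⟪⟫-certified (X ·ᴾ Y) Iᴾ XY==I i j) (sym (identity-matrix k i j)))

  P-unimodular : Unimodular ⟪ Pᴾ e ⟫
  P-unimodular = ⟪ P⁻¹ᴾ e ⟫ , ⟪⟫-inverse (Pᴾ e) (P⁻¹ᴾ e) PP⁻¹≡I , ⟪⟫-inverse (P⁻¹ᴾ e) (Pᴾ e) P⁻¹P≡I

  Q-unimodular : Unimodular ⟪ Qᴾ e ⟫
  Q-unimodular = ⟪ Q⁻¹ᴾ e ⟫ , ⟪⟫-inverse (Qᴾ e) (Q⁻¹ᴾ e) QQ⁻¹≡I , ⟪⟫-inverse (Q⁻¹ᴾ e) (Qᴾ e) Q⁻¹Q≡I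

  starSNF-of : ∀ {M} → M ≈M ⟪ Aᴾ e ⟫ → SNFis M (starSNF (2 ℕ.+ k))
  starSNF-of {M} M≈A = starSNF-isSmithForm (2 ℕ.+ k) , ⟪ Pᴾ e ⟫ , ⟪ Qᴾ e ⟫ , P-unimodular , Q-unimodular , PMQ≈D
    where
    PMQ≈D : ((⟪ Pᴾ e ⟫ ⊗ M) ⊗ ⟪ Qᴾ e ⟫) ≈M starSNF (2 ℕ.+ k)
    PMQ≈D i j = begin
      ((⟪ Pᴾ e ⟫ ⊗ M) ⊗ ⟪ Qᴾ e ⟫) i j            ≡⟨ ⊗-congˡ {B = ⟪ Qᴾ e ⟫} (⊗-congʳ {A = ⟪ Pᴾ e ⟫} M≈A) i j ⟩
      ((⟪ Pᴾ e ⟫ ⊗ ⟪ Aᴾ e ⟫) ⊗ ⟪ Qᴾ e ⟫) i j      ≡⟨ ⊗-congˡ {B = ⟪ Qᴾ e ⟫} (⟪⟫-· (Pᴾ e) (Aᴾ e)) i j ⟩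
      (⟪ Pᴾ e ·ᴾ Aᴾ e ⟫ ⊗ ⟪ Qᴾ e ⟫) i j           ≡⟨ ⟪⟫-· (Pᴾ e ·ᴾ Aᴾ e) (Qᴾ e) i j ⟩
      ⟪ (Pᴾ e ·ᴾ Aᴾ e) ·ᴾ Qᴾ e ⟫ i j              ≡⟨ ⟪⟫-certified ((Pᴾ e ·ᴾ Aᴾ e) ·ᴾ Qᴾ e) Dᴾ PAQ≡D i j ⟩
      ⟪ Dᴾ ⟫ i j                                 ≡˘⟨ snf-matrix k i j ⟩
      starSNF (2 ℕ.+ k) i j                      ∎
      where open ≡-Reasoning

mainTheorem9 : (n : ℕ) → 2 ≤ n → (d : Fin (suc n) → Fin (suc n) → ℕ) →
    IsDistance (star n) d →
    SNFis (Atrs (star n) d) (starSNF n) × SNFis (AtrsPlus (star n) d) (starSNF n)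
mainTheorem9 (suc (suc k)) (s≤s (s≤s z≤n)) d isDist =
  starSNF-of k certificate⁻ (λ i j → trans (cong (_+_ (diagTrs d i j)) (sym (ℤP.-1*i≡-i _)))
                                          (matrix-Aᴾ k -1ℤ isDist i j)) ,
  starSNF-of k certificate⁺ (λ i j → trans (cong (_+_ (diagTrs d i j)) (sym (ℤP.*-identityˡ _)))
                                          (matrix-Aᴾ k 1ℤ isDist i j))
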